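{- Let $k\geq 1$, $n\geq 2k+1$ and $r\geq 2$ be integers. The geometry $\Gamma(KG(n,k),r)$ satisfies the intersection property of rank 2, $(IP)_2$, if and only if $n=2k+1$.
   Context: Let $\Omega=\{1,\ldots,n+k(r-2)\}$, $I=\{1,\ldots,r\}$. The incidence system $\Gamma(KG(n,k),r)=(X,*,t,I)$ has element set $X=X_1\cup\cdots\cup X_r$, a disjoint union of $r$ copies of the set of all $k$-subsets of $\Omega$; $t(x)=i$ for $x\in X_i$; $x\in X_i$ and $y\in X_j$ are incident iff $x=y$ or ($i\neq j$ and $x\cap y=\emptyset$). A flag is a set of pairwise incident elements; the residue of a flag $F$ consists of the elements incident to all elements of $F$ and not in $F$, with types $I\setminus t(F)$ and restricted incidence; a rank two residue is the residue of a flag with $r-2$ elements. In a rank two geometry with types $\{i,j\}$, call elements of type $i$ points and of type $j$ lines; it is a generalised digon if every point is incident to every line, and a partial linear space if any two distinct points are incident to at most one common line. The geometry satisfies $(IP)_2$ if every rank two residue is either a generalised digon or a partial linear space. -}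

module Defs where

open import Data.Nat using (ℕ; _+_; _*_; _∸_)
open import Data.Fin using (Fin)
open import Data.Fin.Subset using (Subset; _∩_; ⊥; ∣_∣)
open import Data.Product using (_×_; _,_; proj₁; proj₂)
open import Data.Sum using (_⊎_)
open import Data.List using (List; length; map)
open import Data.List.Relation.Unary.All using (All)
open import Data.List.Relation.Unary.AllPairs using (AllPairs)
open import Data.List.Relation.Unary.Unique.Propositional using (Unique)
open import Data.List.Membership.Propositional using (_∈_; _∉_)
open import Relation.Binary.PropositionalEquality using (_≡_; _≢_)

-- Ground set Ω = {1,…,n + k(r-2)}, represented as Fin (Ωsize n k r).
Ωsize : ℕ → ℕ → ℕ → ℕ
Ωsize n k r = n + k * (r ∸ 2)

-- A candidate element of Γ(KG(n,k),r): a type i ∈ I = Fin r together with a subset of Ω.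
-- The element set X consists of those candidates whose subset has exactly k elements.
Cand : ℕ → ℕ → ℕ → Set
Cand n k r = Fin r × Subset (Ωsize n k r)

type : ∀ {r m} → Fin r × Subset m → Fin r
type = proj₁

IsElem : ∀ n k r → Cand n k r → Set
IsElem n k r e = ∣ proj₂ e ∣ ≡ k

Disjoint : ∀ {m} → Subset m → Subset m → Set
Disjoint x y = x ∩ y ≡ ⊥

Incident : ∀ {r m} → Fin r × Subset m → Fin r × Subset m → Set
Incident (i , x) (j , y) = (i ≡ j × x ≡ y) ⊎ (i ≢ j × Disjoint x y)

record IsFlag (n k r : ℕ) (F : List (Cand n k r)) : Set where
  field
    elems    : All (IsElem n k r) F
    distinct : Unique F
    pairwise : AllPairs Incident F

InResidue : ∀ n k r → List (Cand n k r) → Cand n k r → Set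
InResidue n k r F z = IsElem n k r z × All (Incident z) F × z ∉ F

IsGenDigon : ∀ n k r → List (Cand n k r) → Fin r → Fin r → Set
IsGenDigon n k r F i j =
  ∀ p l → InResidue n k r F p → InResidue n k r F l →
  type p ≡ i → type l ≡ j → Incident p l

IsPartialLinearSpace : ∀ n k r → List (Cand n k r) → Fin r → Fin r → Set
IsPartialLinearSpace n k r F i j =
  ∀ p q l l' →
  InResidue n k r F p → InResidue n k r F q →
  InResidue n k r F l → InResidue n k r F l' →
  type p ≡ i → type q ≡ i → type l ≡ j → type l' ≡ j →
  p ≢ q →
  Incident p l → Incident q l → Incident p l' → Incident q l' →
  l ≡ l'

-- (IP)_2: every rank two residue (residue of a flag with r-2 elements, with its
-- two remaining types i ≠ j) is a generalised digon or a partial linear space.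
IP2 : ℕ → ℕ → ℕ → Set
IP2 n k r =
  ∀ (F : List (Cand n k r)) → IsFlag n k r F → length F ≡ r ∸ 2 →
  ∀ (i j : Fin r) → i ≢ j → i ∉ map type F → j ∉ map type F →
  IsGenDigon n k r F i j ⊎ IsPartialLinearSpace n k r F i j

-- The r - 2 elements of a flag are pairwise disjoint k-sets, so they cover k(r - 2) points of Ω
-- and every element of the residue lives in the remaining n points. If two distinct points of a
-- rank two residue were joined by two distinct lines, the two points would cover at least k + 1
-- of these n points and the two lines at least k + 1 others, whence n ≥ 2k + 2. Conversely, for
-- n ≥ 2k + 2 take the flag of consecutive k-blocks beyond position n: the residue on the first n
-- positions contains the non-incident pair [0,k), [0,k), so it is no generalised digon, and the
-- points [0,k), [1,k+1) both lie on the distinct lines [k+1,2k+1), [k+2,2k+2).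
module Submission where

open import Defs
open import Data.Nat using (ℕ; _+_; _*_; _≤_)
open import Data.Product using (_×_)
open import Relation.Binary.PropositionalEquality using (_≡_)

import Data.Bool as Bool
open import Data.Nat using (zero; suc; _<_; _∸_; z≤n; s≤s; _≟_)
open import Data.Nat.Properties
  using (≤-refl; ≤-trans; n≤1+n; m≤m+n; +-comm; +-suc; *-suc; *-zeroʳ; *-monoʳ-≤; +-monoʳ-≤; +-monoˡ-≤;
         +-mono-≤; +-cancelˡ-≤; <⇒≱; <⇒≢; m≤n+m; ≤∧≢⇒<; suc-injective; module ≤-Reasoning)
open import Data.Nat.Tactic.RingSolver using (solve-∀)
open import Data.Fin as Fin using (Fin; toℕ; _↑ˡ_; _↑ʳ_)
import Data.Fin.Properties as Finₚ
open import Data.Fin.Subset using (Subset; _∩_; _∪_; ⊥; ∣_∣; inside; outside)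
open import Data.Fin.Subset.Properties
  using (∣p∣≤n; ∣⊥∣≡0; ∣p∣≤∣p∪q∣; ∣q∣≤∣p∪q∣; ∩-comm; ∩-idem; ∩-zeroˡ; ∩-zeroʳ; ∩-distribʳ-∪;
         ∪-identityˡ)
open import Data.Vec using ([]; _∷_)
open import Data.Vec.Properties using (∷-injectiveʳ; ≡-dec)
open import Data.Product using (_,_; proj₁; proj₂)
open import Data.Sum using (inj₁; inj₂; [_,_])
open import Data.List using (List; []; _∷_; length; map; tabulate)
open import Data.List.Properties using (length-tabulate)
open import Data.List.Relation.Unary.All using (All; []; _∷_)
import Data.List.Relation.Unary.All.Properties as All
open import Data.List.Relation.Unary.Any using (here; there)
import Data.List.Relation.Unary.Any.Properties as Any
open import Data.List.Relation.Unary.AllPairs using (AllPairs; []; _∷_)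
import Data.List.Relation.Unary.AllPairs.Properties as AllPairs
open import Data.List.Relation.Unary.Unique.Propositional using (Unique)
import Data.List.Relation.Unary.Unique.Propositional.Properties as Unique
open import Data.List.Membership.Propositional using (_∉_)
open import Function using (_∘_)
open import Relation.Binary.PropositionalEquality
  using (refl; sym; trans; cong; cong₂; subst; _≢_; module ≡-Reasoning)
open import Relation.Binary.Definitions using (tri<; tri≈; tri>)
open import Relation.Nullary using (¬_; yes; no; contradiction)
open import Relation.Nullary.Decidable using (decidable-stable)

module _ {m : ℕ} where

  Disjoint-sym : {p q : Subset m} → Disjoint p q → Disjoint q p
  Disjoint-sym {p} {q} p∩q≡⊥ = trans (∩-comm q p) p∩q≡⊥

  Disjoint-∪ˡ : {p q s : Subset m} → Disjoint p s → Disjoint q s → Disjoint (p ∪ q) s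
  Disjoint-∪ˡ {p} {q} {s} p∩s≡⊥ q∩s≡⊥ = begin
    (p ∪ q) ∩ s        ≡⟨ ∩-distribʳ-∪ s p q ⟩
    (p ∩ s) ∪ (q ∩ s)  ≡⟨ cong₂ _∪_ p∩s≡⊥ q∩s≡⊥ ⟩
    ⊥ ∪ ⊥              ≡⟨ ∪-identityˡ ⊥ ⟩
    ⊥                  ∎
    where open ≡-Reasoning

  Disjoint-∪ʳ : {s p q : Subset m} → Disjoint s p → Disjoint s q → Disjoint s (p ∪ q)
  Disjoint-∪ʳ s∩p≡⊥ s∩q≡⊥ = Disjoint-sym (Disjoint-∪ˡ (Disjoint-sym s∩p≡⊥) (Disjoint-sym s∩q≡⊥))

  Disjoint-self⇒≡⊥ : {p : Subset m} → Disjoint p p → p ≡ ⊥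
  Disjoint-self⇒≡⊥ {p} p∩p≡⊥ = trans (sym (∩-idem p)) p∩p≡⊥

∣p∪q∣≡∣p∣+∣q∣ : ∀ {m} {p q : Subset m} → Disjoint p q → ∣ p ∪ q ∣ ≡ ∣ p ∣ + ∣ q ∣
∣p∪q∣≡∣p∣+∣q∣ {p = []}          {[]}          _ = refl
∣p∪q∣≡∣p∣+∣q∣ {p = inside  ∷ p} {inside  ∷ q} ()
∣p∪q∣≡∣p∣+∣q∣ {p = inside  ∷ p} {outside ∷ q} d = cong suc (∣p∪q∣≡∣p∣+∣q∣ (∷-injectiveʳ d))
∣p∪q∣≡∣p∣+∣q∣ {p = outside ∷ p} {inside  ∷ q} d =
  trans (cong suc (∣p∪q∣≡∣p∣+∣q∣ (∷-injectiveʳ d))) (sym (+-suc ∣ p ∣ ∣ q ∣))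
∣p∪q∣≡∣p∣+∣q∣ {p = outside ∷ p} {outside ∷ q} d = ∣p∪q∣≡∣p∣+∣q∣ (∷-injectiveʳ d)

∣p∣+∣q∣≤n : ∀ {m} {p q : Subset m} → Disjoint p q → ∣ p ∣ + ∣ q ∣ ≤ m
∣p∣+∣q∣≤n {p = p} {q} d = subst (_≤ _) (∣p∪q∣≡∣p∣+∣q∣ d) (∣p∣≤n (p ∪ q))

∣p∣<∣p∪q∣ : ∀ {m} {p q : Subset m} → p ≢ q → ∣ p ∣ ≡ ∣ q ∣ → ∣ p ∣ < ∣ p ∪ q ∣
∣p∣<∣p∪q∣ {p = []}          {[]}          p≢q _ = contradiction refl p≢q
∣p∣<∣p∪q∣ {p = inside  ∷ p} {inside  ∷ q} p≢q e =
  s≤s (∣p∣<∣p∪q∣ (p≢q ∘ cong (inside ∷_)) (suc-injective e))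
∣p∣<∣p∪q∣ {p = outside ∷ p} {outside ∷ q} p≢q e = ∣p∣<∣p∪q∣ (p≢q ∘ cong (outside ∷_)) e
∣p∣<∣p∪q∣ {p = inside  ∷ p} {outside ∷ q} _   e = s≤s (subst (_≤ ∣ p ∪ q ∣) (sym e) (∣q∣≤∣p∪q∣ p q))
∣p∣<∣p∪q∣ {p = outside ∷ p} {inside  ∷ q} _   _ = s≤s (∣p∣≤∣p∪q∣ p q)

Incident⇒Disjoint : ∀ {r m} {x y : Fin r × Subset m} →
  x ≢ y → Incident x y → Disjoint (proj₂ x) (proj₂ y)
Incident⇒Disjoint x≢y (inj₁ (refl , refl)) = contradiction refl x≢y
Incident⇒Disjoint _   (inj₂ (_ , d))       = d

support : ∀ {r m} → List (Fin r × Subset m) → Subset m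
support []      = ⊥
support (x ∷ F) = proj₂ x ∪ support F

Disjoint-support : ∀ {r m} {z : Fin r × Subset m} {F} →
  All (Incident z) F → z ∉ F → Disjoint (proj₂ z) (support F)
Disjoint-support []          _     = ∩-zeroʳ _
Disjoint-support (z∼x ∷ z∼F) z∉x∷F =
  Disjoint-∪ʳ (Incident⇒Disjoint (z∉x∷F ∘ here) z∼x) (Disjoint-support z∼F (z∉x∷F ∘ there))

∣support∣ : ∀ {r m k} {F : List (Fin r × Subset m)} →
  All (λ x → ∣ proj₂ x ∣ ≡ k) F → Unique F → AllPairs Incident F → ∣ support F ∣ ≡ k * length F
∣support∣ {m = m} {k} [] [] [] = trans (∣⊥∣≡0 m) (sym (*-zeroʳ k))
∣support∣ {k = k} {x ∷ F} (∣x∣≡k ∷ ∣F∣≡k) (x∉F ∷ F!) (x∼F ∷ F∼F) = begin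
  ∣ proj₂ x ∪ support F ∣        ≡⟨ ∣p∪q∣≡∣p∣+∣q∣ (Disjoint-support x∼F (All.All¬⇒¬Any x∉F)) ⟩
  ∣ proj₂ x ∣ + ∣ support F ∣    ≡⟨ cong₂ _+_ ∣x∣≡k (∣support∣ ∣F∣≡k F! F∼F) ⟩
  k + k * length F               ≡⟨ *-suc k (length F) ⟨
  k * suc (length F)             ∎
  where open ≡-Reasoning

1+[2k+1]≡[1+k]+[1+k] : ∀ k → suc (2 * k + 1) ≡ suc k + suc k
1+[2k+1]≡[1+k]+[1+k] = solve-∀

module _ {n k r : ℕ} {F : List (Cand n k r)} (flag : IsFlag n k r F) (∣F∣ : length F ≡ r ∸ 2) where

  open IsFlag flag

  residue-room : {p q : Subset (Ωsize n k r)} →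
    Disjoint p (support F) → Disjoint q (support F) → Disjoint p q → ∣ p ∣ + ∣ q ∣ ≤ n
  residue-room {p} {q} p∩W≡⊥ q∩W≡⊥ p∩q≡⊥ = +-cancelˡ-≤ (k * (r ∸ 2)) _ _ (begin
    k * (r ∸ 2) + (∣ p ∣ + ∣ q ∣)  ≡⟨ cong₂ _+_ ∣W∣ (∣p∪q∣≡∣p∣+∣q∣ p∩q≡⊥) ⟨
    ∣ support F ∣ + ∣ p ∪ q ∣      ≤⟨ ∣p∣+∣q∣≤n (Disjoint-sym (Disjoint-∪ˡ p∩W≡⊥ q∩W≡⊥)) ⟩
    n + k * (r ∸ 2)                ≡⟨ +-comm n _ ⟩
    k * (r ∸ 2) + n                ∎)
    where
      open ≤-Reasoning
      ∣W∣ : ∣ support F ∣ ≡ k * (r ∸ 2)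
      ∣W∣ = trans (∣support∣ elems distinct pairwise) (cong (k *_) ∣F∣)

  residue-isPartialLinearSpace : ∀ {i j} → n ≤ 2 * k + 1 → i ≢ j → IsPartialLinearSpace n k r F i j
  residue-isPartialLinearSpace n≤2k+1 i≢j
    (_ , p) (_ , q) (_ , l) (_ , l')
    (∣p∣≡k , p∼F , p∉F) (∣q∣≡k , q∼F , q∉F) (∣l∣≡k , l∼F , l∉F) (∣l'∣≡k , l'∼F , l'∉F)
    refl refl refl refl p≢q p∼l q∼l p∼l' q∼l' with ≡-dec Bool._≟_ l l'
  ... | yes refl = refl
  ... | no l≢l' = contradiction n≤2k+1 (<⇒≱ (begin-strict
    2 * k + 1                      <⟨ 2k+1<[1+k]+[1+k] ⟩
    suc k + suc k                  ≤⟨ +-mono-≤ (two-elements (p≢q ∘ cong (_ ,_)) ∣p∣≡k ∣q∣≡k)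
                                               (two-elements l≢l' ∣l∣≡k ∣l'∣≡k) ⟩
    ∣ p ∪ q ∣ + ∣ l ∪ l' ∣          ≤⟨ residue-room points-off-flag lines-off-flag points-off-lines ⟩
    n                              ∎))
    where
      open ≤-Reasoning
      point-line : ∀ {x y : Subset (Ωsize n k r)} → Incident (_ , x) (_ , y) → Disjoint x y
      point-line = Incident⇒Disjoint (i≢j ∘ cong proj₁)
      points-off-flag : Disjoint (p ∪ q) (support F)
      points-off-flag = Disjoint-∪ˡ (Disjoint-support p∼F p∉F) (Disjoint-support q∼F q∉F)
      lines-off-flag : Disjoint (l ∪ l') (support F)
      lines-off-flag = Disjoint-∪ˡ (Disjoint-support l∼F l∉F) (Disjoint-support l'∼F l'∉F)
      points-off-lines : Disjoint (p ∪ q) (l ∪ l')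
      points-off-lines = Disjoint-∪ˡ (Disjoint-∪ʳ (point-line p∼l) (point-line p∼l'))
                                     (Disjoint-∪ʳ (point-line q∼l) (point-line q∼l'))
      2k+1<[1+k]+[1+k] : 2 * k + 1 < suc k + suc k
      2k+1<[1+k]+[1+k] = subst (2 * k + 1 <_) (1+[2k+1]≡[1+k]+[1+k] k) ≤-refl
      two-elements : ∀ {x y : Subset (Ωsize n k r)} → x ≢ y →
        ∣ x ∣ ≡ k → ∣ y ∣ ≡ k → suc k ≤ ∣ x ∪ y ∣
      two-elements {x} {y} x≢y ∣x∣≡k ∣y∣≡k =
        subst (λ c → suc c ≤ ∣ x ∪ y ∣) ∣x∣≡k (∣p∣<∣p∪q∣ x≢y (trans ∣x∣≡k (sym ∣y∣≡k)))

IP2-if-n≤2k+1 : ∀ {n k r} → n ≤ 2 * k + 1 → IP2 n k r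
IP2-if-n≤2k+1 n≤2k+1 F flag ∣F∣ i j i≢j _ _ = inj₂ (residue-isPartialLinearSpace flag ∣F∣ n≤2k+1 i≢j)

-- The positions a, a + 1, …, a + l - 1 of Fin m, truncated at m.
interval : ∀ m → ℕ → ℕ → Subset m
interval zero    _       _       = []
interval (suc m) zero    zero    = ⊥
interval (suc m) zero    (suc l) = inside ∷ interval m zero l
interval (suc m) (suc a) l       = outside ∷ interval m a l

∣interval∣ : ∀ {m} a l → a + l ≤ m → ∣ interval m a l ∣ ≡ l
∣interval∣ {zero}  zero    zero    _         = refl
∣interval∣ {suc m} zero    zero    _         = ∣⊥∣≡0 (suc m)
∣interval∣ {suc m} zero    (suc l) (s≤s l≤m) = cong suc (∣interval∣ zero l l≤m)
∣interval∣ {suc m} (suc a) l       (s≤s a+l≤m) = ∣interval∣ a l a+l≤m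

interval-disjoint : ∀ {m} a l {b l'} → a + l ≤ b → Disjoint (interval m a l) (interval m b l')
interval-disjoint {zero}  _       _       _   = refl
interval-disjoint {suc m} zero    zero    _   = ∩-zeroˡ _
interval-disjoint {suc m} zero    (suc l) {suc b} (s≤s l≤b) = cong (outside ∷_) (interval-disjoint zero l l≤b)
interval-disjoint {suc m} (suc a) l       {suc b} (s≤s a+l≤b) = cong (outside ∷_) (interval-disjoint a l a+l≤b)

interval-suc-≢ : ∀ {m} a l → 1 ≤ l → a + l ≤ m → interval m a l ≢ interval m (suc a) l
interval-suc-≢ {suc m} zero    (suc l) _   _           ()
interval-suc-≢ {suc m} (suc a) l       1≤l (s≤s a+l≤m) e = interval-suc-≢ a l 1≤l a+l≤m (∷-injectiveʳ e)

interval≢⊥ : ∀ {m} a l → 1 ≤ l → a + l ≤ m → interval m a l ≢ ⊥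
interval≢⊥ {m} a l 1≤l a+l≤m interval≡⊥ = <⇒≢ 1≤l (begin
  0                       ≡⟨ ∣⊥∣≡0 m ⟨
  ∣ ⊥ {m} ∣               ≡⟨ cong ∣_∣ interval≡⊥ ⟨
  ∣ interval m a l ∣      ≡⟨ ∣interval∣ a l a+l≤m ⟩
  l                       ∎)
  where open ≡-Reasoning

n+k*t+k≡n+k*[1+t] : ∀ n k t → n + k * t + k ≡ n + k * suc t
n+k*t+k≡n+k*[1+t] = solve-∀

1+[2k+1]≡2+k+k : ∀ k → suc (2 * k + 1) ≡ 2 + k + k
1+[2k+1]≡2+k+k = solve-∀

module Counterexample {k n r : ℕ} (1≤k : 1 ≤ k) (2k+1<n : 2 * k + 1 < n) where

  Ω : ℕ
  Ω = Ωsize n k (2 + r)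

  block : Fin r → Cand n k (2 + r)
  block t = 2 ↑ʳ t , interval Ω (n + k * toℕ t) k

  blocks : List (Cand n k (2 + r))
  blocks = tabulate block

  block-end : ∀ (t : Fin r) {s} → toℕ t < s → n + k * toℕ t + k ≤ n + k * s
  block-end t {s} t<s = subst (_≤ n + k * s) (sym (n+k*t+k≡n+k*[1+t] n k (toℕ t)))
                          (+-monoʳ-≤ n (*-monoʳ-≤ k t<s))

  block-incident : ∀ {s t} → s ≢ t → Incident (block s) (block t)
  block-incident {s} {t} s≢t with Finₚ.<-cmp s t
  ... | tri< s<t _ _ = inj₂ (s≢t ∘ Finₚ.suc-injective ∘ Finₚ.suc-injective ,
                             interval-disjoint (n + k * toℕ s) k (block-end s s<t))
  ... | tri≈ _ s≡t _ = contradiction s≡t s≢t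
  ... | tri> _ _ t<s = inj₂ (s≢t ∘ Finₚ.suc-injective ∘ Finₚ.suc-injective ,
                             Disjoint-sym (interval-disjoint (n + k * toℕ t) k (block-end t t<s)))

  blocks-isFlag : IsFlag n k (2 + r) blocks
  blocks-isFlag = record
    { elems    = All.tabulate⁺ λ t → ∣interval∣ (n + k * toℕ t) k (block-end t (Finₚ.toℕ<n t))
    ; distinct = Unique.tabulate⁺ (Finₚ.suc-injective ∘ Finₚ.suc-injective ∘ cong proj₁)
    ; pairwise = AllPairs.tabulate⁺ block-incident
    }

  room : ∀ {a} → a ≤ 2 + k → a + k ≤ n
  room {a} a≤2+k = ≤-trans (+-monoˡ-≤ k a≤2+k) (subst (_≤ n) (1+[2k+1]≡2+k+k k) 2k+1<n)

  low : Fin 2 → Fin (2 + r)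
  low i = i ↑ˡ r

  low≢2↑ʳ : ∀ i t → low i ≢ 2 ↑ʳ t
  low≢2↑ʳ Fin.zero            _ ()
  low≢2↑ʳ (Fin.suc Fin.zero) _ ()

  element : Fin 2 → ℕ → Cand n k (2 + r)
  element i a = low i , interval Ω a k

  low∉types : ∀ i → low i ∉ map type blocks
  low∉types i i∈types = let (t , i≡t) = Any.tabulate⁻ (Any.map⁻ i∈types) in low≢2↑ʳ i t i≡t

  fits : ∀ {a} → a + k ≤ n → a + k ≤ Ω
  fits a+k≤n = ≤-trans a+k≤n (m≤m+n n _)

  element∈residue : ∀ i a → a + k ≤ n → InResidue n k (2 + r) blocks (element i a)
  element∈residue i a a+k≤n =
    ∣interval∣ a k (fits a+k≤n) ,
    All.tabulate⁺ (λ t → inj₂ (low≢2↑ʳ i t , interval-disjoint a k (≤-trans a+k≤n (m≤m+n n _)))) ,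
    λ e∈blocks → let (t , e≡t) = Any.tabulate⁻ e∈blocks in low≢2↑ʳ i t (cong proj₁ e≡t)

  point line : ℕ → Cand n k (2 + r)
  point = element Fin.zero
  line  = element (Fin.suc Fin.zero)

  point∈residue : ∀ {a} → a ≤ 2 + k → InResidue n k (2 + r) blocks (point a)
  point∈residue {a} a≤2+k = element∈residue _ a (room a≤2+k)

  line∈residue : ∀ {a} → a ≤ 2 + k → InResidue n k (2 + r) blocks (line a)
  line∈residue {a} a≤2+k = element∈residue _ a (room a≤2+k)

  point-line-incident : ∀ {a b} → a + k ≤ b → Incident (point a) (line b)
  point-line-incident {a} a+k≤b = inj₂ ((λ ()) , interval-disjoint a k a+k≤b)

  ¬isGenDigon : ¬ IsGenDigon n k (2 + r) blocks (low Fin.zero) (low (Fin.suc Fin.zero))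
  ¬isGenDigon digon
    with digon (point 0) (line 0) (point∈residue z≤n) (line∈residue z≤n) refl refl
  ... | inj₁ (() , _)
  ... | inj₂ (_ , self-disjoint) = interval≢⊥ 0 k 1≤k (fits (room z≤n)) (Disjoint-self⇒≡⊥ self-disjoint)

  ¬isPartialLinearSpace : ¬ IsPartialLinearSpace n k (2 + r) blocks (low Fin.zero) (low (Fin.suc Fin.zero))
  ¬isPartialLinearSpace pls = interval-suc-≢ (suc k) k 1≤k (fits (room (n≤1+n _))) (cong proj₂
    (pls (point 0) (point 1) (line (suc k)) (line (2 + k))
         (point∈residue z≤n) (point∈residue (s≤s z≤n)) (line∈residue (n≤1+n _)) (line∈residue ≤-refl)
         refl refl refl refl
         (interval-suc-≢ 0 k 1≤k (fits (room z≤n)) ∘ cong proj₂)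
         (point-line-incident (n≤1+n k)) (point-line-incident ≤-refl)
         (point-line-incident (m≤n+m k 2)) (point-line-incident (n≤1+n _))))

  ¬IP2 : ¬ IP2 n k (2 + r)
  ¬IP2 ip2 = [ ¬isGenDigon , ¬isPartialLinearSpace ]
    (ip2 blocks blocks-isFlag (length-tabulate block) _ _ (λ ()) (low∉types _) (low∉types _))

¬IP2-if-2k+1<n : ∀ {n k r} → 1 ≤ k → 2 * k + 1 < n → 2 ≤ r → ¬ IP2 n k r
¬IP2-if-2k+1<n {r = suc (suc r)} 1≤k 2k+1<n (s≤s (s≤s _)) = Counterexample.¬IP2 {r = r} 1≤k 2k+1<n

corollary4p12 : ∀ (k n r : ℕ) → 1 ≤ k → 2 * k + 1 ≤ n → 2 ≤ r →
    (IP2 n k r → n ≡ 2 * k + 1) × (n ≡ 2 * k + 1 → IP2 n k r)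
corollary4p12 k n r 1≤k 2k+1≤n 2≤r = forward , λ { refl → IP2-if-n≤2k+1 ≤-refl }
  where
    forward : IP2 n k r → n ≡ 2 * k + 1
    forward ip2 = decidable-stable (n ≟ 2 * k + 1) λ n≢2k+1 →
      ¬IP2-if-2k+1<n 1≤k (≤∧≢⇒< 2k+1≤n (n≢2k+1 ∘ sym)) 2≤r ip2
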